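{- Let $e_n$ ($n\ge1$) be the unique rational numbers with $\exp(x)=\sum_{n\ge0}\frac{x^n}{n!}=\prod_{n\ge1}(1+e_nx^n)$ as formal power series. Let $u_n=\prod_{k=1}^n\gcd(k,n)$ and $r_n=u_ne_n$. Then $r_n$ is an integer for every $n\ge1$. -}

module Defs where

open import Data.Nat as ℕ using (ℕ; zero; suc; _!; _≤_)
open import Data.Nat.Properties using (_!≢0)
open import Data.Nat.GCD using (gcd)
open import Data.Integer using (ℤ; +_)
open import Data.Rational using (ℚ; 0ℚ; 1ℚ; _+_; _*_; _/_)
open import Relation.Nullary using (yes; no)

PowerSeries : Set
PowerSeries = ℕ → ℚ

sumTo : ℕ → (ℕ → ℚ) → ℚ
sumTo zero    f = f zero
sumTo (suc n) f = sumTo n f + f (suc n)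

_⊛_ : PowerSeries → PowerSeries → PowerSeries
(f ⊛ g) n = sumTo n (λ i → f i * g (n ℕ.∸ i))

oneSeries : PowerSeries
oneSeries zero    = 1ℚ
oneSeries (suc _) = 0ℚ

-- The series 1 + a x^n  (for n ≥ 1; we only use it with n ≥ 1).
onePlusMonomial : ℚ → ℕ → PowerSeries
onePlusMonomial a n m with m ℕ.≟ 0 | m ℕ.≟ n
... | yes _ | _     = 1ℚ
... | no _  | yes _ = a
... | no _  | no _  = 0ℚ

partialProduct : (ℕ → ℚ) → ℕ → PowerSeries
partialProduct e zero    = oneSeries
partialProduct e (suc N) = partialProduct e N ⊛ onePlusMonomial (e (suc N)) (suc N)

expSeries : PowerSeries
expSeries n = (+ 1) / (n !) where instance _ = n !≢0

-- exp(x) = ∏_{n≥1} (1 + e_n x^n) as formal power series: the coefficient of x^N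
-- of the infinite product is that of the finite product over 1 ≤ n ≤ N
-- (later factors are ≡ 1 mod x^{N+1}).
IsExpProductExponents : (ℕ → ℚ) → Set
IsExpProductExponents e = ∀ N → partialProduct e N N ≡ expSeries N
  where open import Relation.Binary.PropositionalEquality using (_≡_)

gcdProdTo : ℕ → ℕ → ℕ
gcdProdTo zero    n = 1
gcdProdTo (suc k) n = gcdProdTo k n ℕ.* gcd (suc k) n

u : ℕ → ℕ
u n = gcdProdTo n n

-- Let Q_N = ∏_{n ≤ N} (1 + e_n x^n) and let θ = x d/dx act on
-- coefficients by F_j ↦ j F_j.  The logarithmic derivative of one factor,
-- T_n = θ log(1 + e_n x^n) = -n Σ_{q ≥ 1} (-e_n)^q x^{qn}, is characterised by
-- (1 + e_n x^n) T_n = n e_n x^n; multiplying the factors out one at a time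
-- gives θ Q_N = Q_N S_N with S_N = Σ_{n ≤ N} T_n.  As Q_N agrees with exp up to
-- degree N and θ exp = x exp, Q_N (S_N - x) vanishes up to degree N, and since
-- Q_N has constant term 1 so does S_N - x.  The coefficient of x^N, N = K + 1, is
--   N e_N = [N = 1] + Σ_{n ≤ K, qn = N} n (-e_n)^q.
-- Multiplying by c = u_N / N and using u_n^q ∣ c n (the gcd-product of N is
-- periodic in blocks of length n), every term is an integer multiple of
-- (u_n (-e_n))^q, so strong induction on N proves the claim.

module Submission where

open import Defs
open import Data.Nat using (ℕ; _≥_)
open import Data.Integer using (ℤ; +_)
open import Data.Rational using (ℚ; _*_; _/_)
open import Data.Product using (∃)
open import Relation.Binary.PropositionalEquality using (_≡_)

open import Algebra.Bundles using (CommutativeRing)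
open import Data.Empty using (⊥-elim)
open import Data.Integer as ℤ using (-[1+_])
import Data.Integer.Properties as ℤP
open import Data.Nat as ℕ using (zero; suc; _≤_; _<_; z≤n; s≤s; _∸_; _!; NonZero)
import Data.Nat.Coprimality as Coprime
open import Data.Nat.Divisibility using (_∣_; divides; ∣-refl; ∣-trans; ∣-antisym; *-pres-∣; ∣m∣n⇒∣m+n; n∣m*n)
import Data.Nat.DivMod as DM
open import Data.Nat.GCD using (gcd; gcd[m,n]∣m; gcd[m,n]∣n; gcd-greatest)
open import Data.Nat.Induction using (<-rec)
import Data.Nat.Properties as ℕP
open import Data.Product using (_,_)
open import Data.Rational using (mkℚ; _+_; _-_; -_; 0ℚ; 1ℚ)
import Data.Rational.Properties as ℚP
open import Data.Rational.Solver using (module +-*-Solver)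
open import Relation.Binary.PropositionalEquality using (refl; sym; trans; cong; cong₂; subst; subst₂; _≢_; module ≡-Reasoning)
open import Relation.Nullary using (yes; no)

open import Algebra.Properties.CommutativeSemiring.Exp (CommutativeRing.commutativeSemiring ℚP.+-*-commutativeRing) using (_^_; ^-distrib-*)
open +-*-Solver
open ≡-Reasoning

IsInt : ℚ → Set
IsInt x = ∃ λ (z : ℤ) → x ≡ z / 1

ι : ℕ → ℚ
ι n = + n / 1

-- z / 1 is already in lowest terms, so it is literally the fraction z over 1;
-- this makes the embedding of ℤ into ℚ compute.
/1-canonical : ∀ z → z / 1 ≡ mkℚ z 0 (Coprime.sym (Coprime.1-coprimeTo ℤ.∣ z ∣))
/1-canonical (+ n)    = ℚP.normalize-coprime (Coprime.sym (Coprime.1-coprimeTo n))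
/1-canonical -[1+ n ] = cong -_ (ℚP.normalize-coprime (Coprime.sym (Coprime.1-coprimeTo (suc n))))

/1-homo-+ : ∀ a b → (a / 1) + (b / 1) ≡ (a ℤ.+ b) / 1
/1-homo-+ a b rewrite /1-canonical a | /1-canonical b | ℤP.*-identityʳ a | ℤP.*-identityʳ b = refl

/1-homo-* : ∀ a b → (a / 1) * (b / 1) ≡ (a ℤ.* b) / 1
/1-homo-* a b rewrite /1-canonical a | /1-canonical b = refl

/1-homo-neg : ∀ a → - (a / 1) ≡ (ℤ.- a) / 1
/1-homo-neg a rewrite /1-canonical a | /1-canonical (ℤ.- a) = neg-canonical a
  where
  neg-canonical : ∀ a → - mkℚ a 0 (Coprime.sym (Coprime.1-coprimeTo ℤ.∣ a ∣))
                      ≡ mkℚ (ℤ.- a) 0 (Coprime.sym (Coprime.1-coprimeTo ℤ.∣ ℤ.- a ∣))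
  neg-canonical (+ zero)  = refl
  neg-canonical (+ suc n) = refl
  neg-canonical -[1+ n ]  = refl

ι-homo-+ : ∀ m n → ι (m ℕ.+ n) ≡ ι m + ι n
ι-homo-+ m n = trans (cong (_/ 1) (ℤP.pos-+ m n)) (sym (/1-homo-+ (+ m) (+ n)))

ι-homo-* : ∀ m n → ι (m ℕ.* n) ≡ ι m * ι n
ι-homo-* m n = trans (cong (_/ 1) (ℤP.pos-* m n)) (sym (/1-homo-* (+ m) (+ n)))

ι-homo-^ : ∀ m k → ι (m ℕ.^ k) ≡ ι m ^ k
ι-homo-^ m zero    = refl
ι-homo-^ m (suc k) = trans (ι-homo-* m (m ℕ.^ k)) (cong (ι m *_) (ι-homo-^ m k))

IsInt-0 : IsInt 0ℚ
IsInt-0 = + 0 , refl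

IsInt-ι : ∀ n → IsInt (ι n)
IsInt-ι n = + n , refl

IsInt-+ : ∀ {x y} → IsInt x → IsInt y → IsInt (x + y)
IsInt-+ (a , refl) (b , refl) = a ℤ.+ b , /1-homo-+ a b

IsInt-* : ∀ {x y} → IsInt x → IsInt y → IsInt (x * y)
IsInt-* (a , refl) (b , refl) = a ℤ.* b , /1-homo-* a b

IsInt-neg : ∀ {x} → IsInt x → IsInt (- x)
IsInt-neg (a , refl) = ℤ.- a , /1-homo-neg a

IsInt-- : ∀ {x y} → IsInt x → IsInt y → IsInt (x - y)
IsInt-- p q = IsInt-+ p (IsInt-neg q)

IsInt-^ : ∀ {x} k → IsInt x → IsInt (x ^ k)
IsInt-^ zero    _ = + 1 , refl
IsInt-^ (suc k) p = IsInt-* p (IsInt-^ k p)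

sumTo-cong : ∀ n {f g : ℕ → ℚ} → (∀ i → i ≤ n → f i ≡ g i) → sumTo n f ≡ sumTo n g
sumTo-cong zero    f≗g = f≗g 0 z≤n
sumTo-cong (suc n) f≗g =
  cong₂ _+_ (sumTo-cong n (λ i i≤n → f≗g i (ℕP.m≤n⇒m≤1+n i≤n))) (f≗g (suc n) ℕP.≤-refl)

sumTo-zero : ∀ n {f} → (∀ i → i ≤ n → f i ≡ 0ℚ) → sumTo n f ≡ 0ℚ
sumTo-zero n f≗0 = trans (sumTo-cong n f≗0) (sumTo-0 n)
  where
  sumTo-0 : ∀ n → sumTo n (λ _ → 0ℚ) ≡ 0ℚ
  sumTo-0 zero    = refl
  sumTo-0 (suc n) = cong (_+ 0ℚ) (sumTo-0 n)

sumTo-+ : ∀ n f g → sumTo n (λ i → f i + g i) ≡ sumTo n f + sumTo n g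
sumTo-+ zero    f g = refl
sumTo-+ (suc n) f g rewrite sumTo-+ n f g =
  solve 4 (λ a b c d → (a :+ b) :+ (c :+ d) := (a :+ c) :+ (b :+ d)) refl
    (sumTo n f) (sumTo n g) (f (suc n)) (g (suc n))

sumTo-* : ∀ n c f → sumTo n (λ i → c * f i) ≡ c * sumTo n f
sumTo-* zero    c f = refl
sumTo-* (suc n) c f rewrite sumTo-* n c f = sym (ℚP.*-distribˡ-+ c _ _)

sumTo-suc : ∀ n f → sumTo (suc n) f ≡ f 0 + sumTo n (λ i → f (suc i))
sumTo-suc zero    f = refl
sumTo-suc (suc n) f rewrite sumTo-suc n f =
  ℚP.+-assoc (f 0) (sumTo n (λ i → f (suc i))) (f (suc (suc n)))

sumTo-reverse : ∀ n f → sumTo n f ≡ sumTo n (λ i → f (n ∸ i))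
sumTo-reverse zero    f = refl
sumTo-reverse (suc n) f = begin
  sumTo n f + f (suc n)                       ≡⟨ cong (_+ f (suc n)) (sumTo-reverse n f) ⟩
  sumTo n (λ i → f (n ∸ i)) + f (suc n)       ≡⟨ ℚP.+-comm _ (f (suc n)) ⟩
  f (suc n) + sumTo n (λ i → f (n ∸ i))       ≡⟨ sym (sumTo-suc n (λ i → f (suc n ∸ i))) ⟩
  sumTo (suc n) (λ i → f (suc n ∸ i))         ∎

sumTo-truncate : ∀ d k g → (∀ i → k < i → i ≤ d ℕ.+ k → g i ≡ 0ℚ) → sumTo (d ℕ.+ k) g ≡ sumTo k g
sumTo-truncate zero    k g _     = refl
sumTo-truncate (suc d) k g g≗0 =
  trans (cong₂ _+_ (sumTo-truncate d k g (λ i k<i i≤ → g≗0 i k<i (ℕP.m≤n⇒m≤1+n i≤)))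
                   (g≗0 (suc (d ℕ.+ k)) (s≤s (ℕP.m≤n+m k d)) ℕP.≤-refl))
        (ℚP.+-identityʳ _)

-- The Cauchy product.  Only the right argument needs congruence and linearity
-- lemmas, since commutativity moves any factor there.

⊛-comm : ∀ A B j → (A ⊛ B) j ≡ (B ⊛ A) j
⊛-comm A B j = trans (sumTo-reverse j (λ i → A i * B (j ∸ i)))
  (sumTo-cong j (λ i i≤j → trans (cong (λ k → A (j ∸ i) * B k) (ℕP.m∸[m∸n]≡n i≤j))
                                 (ℚP.*-comm (A (j ∸ i)) (B i))))

⊛-congʳ : ∀ A {G H} j → (∀ i → G i ≡ H i) → (A ⊛ G) j ≡ (A ⊛ H) j
⊛-congʳ A j G≗H = sumTo-cong j (λ i _ → cong (A i *_) (G≗H (j ∸ i)))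

⊛-+ʳ : ∀ A G H j → (A ⊛ (λ i → G i + H i)) j ≡ (A ⊛ G) j + (A ⊛ H) j
⊛-+ʳ A G H j = trans (sumTo-cong j (λ i _ → ℚP.*-distribˡ-+ (A i) _ _))
                     (sumTo-+ j (λ i → A i * G (j ∸ i)) (λ i → A i * H (j ∸ i)))

⊛-*ʳ : ∀ A c G j → (A ⊛ (λ i → c * G i)) j ≡ c * (A ⊛ G) j
⊛-*ʳ A c G j = trans (sumTo-cong j (λ i _ →
    solve 3 (λ a c g → a :* (c :* g) := c :* (a :* g)) refl (A i) c (G (j ∸ i))))
  (sumTo-* j c _)

shift : ℕ → PowerSeries → PowerSeries
shift m G j with m ℕ.≤? j
... | yes _ = G (j ∸ m)
... | no _  = 0ℚ

data Split (m j : ℕ) : Set where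
  below : j < m → Split m j
  above : ∀ k → j ≡ m ℕ.+ k → Split m j

split : ∀ m j → Split m j
split m j with m ℕ.≤? j
... | yes m≤j = above (j ∸ m) (sym (ℕP.m+[n∸m]≡n m≤j))
... | no  m≰j = below (ℕP.≰⇒> m≰j)

shift-+ : ∀ m G k → shift m G (m ℕ.+ k) ≡ G k
shift-+ m G k with m ℕ.≤? m ℕ.+ k
... | yes _   = cong G (ℕP.m+n∸m≡n m k)
... | no  m≰j = ⊥-elim (m≰j (ℕP.m≤m+n m k))

shift-< : ∀ m G j → j < m → shift m G j ≡ 0ℚ
shift-< m G j j<m with m ℕ.≤? j
... | yes m≤j = ⊥-elim (ℕP.<⇒≱ j<m m≤j)
... | no  _   = refl

shift-agree : ∀ m N {F G} → (∀ i → i ≤ N → F i ≡ G i) → ∀ j → j ≤ N → shift m F j ≡ shift m G j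
shift-agree m N F≗G j j≤N with split m j
... | below j<m        = trans (shift-< m _ j j<m) (sym (shift-< m _ j j<m))
... | above k refl = trans (shift-+ m _ k)
  (trans (F≗G k (ℕP.≤-trans (ℕP.m≤n+m k m) j≤N)) (sym (shift-+ m _ k)))

shift-cong : ∀ m {F G} → (∀ i → F i ≡ G i) → ∀ j → shift m F j ≡ shift m G j
shift-cong m F≗G j = shift-agree m j (λ i _ → F≗G i) j ℕP.≤-refl

⊛-shiftʳ : ∀ m A G j → (A ⊛ shift m G) j ≡ shift m (A ⊛ G) j
⊛-shiftʳ m A G j with split m j
... | below j<m = trans
  (sumTo-zero j (λ i i≤j → trans (cong (A i *_) (shift-< m G (j ∸ i) (ℕP.≤-<-trans (ℕP.m∸n≤m j i) j<m)))
                                 (ℚP.*-zeroʳ (A i))))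
  (sym (shift-< m (A ⊛ G) j j<m))
... | above k refl = begin
  sumTo (m ℕ.+ k) (λ i → A i * shift m G (m ℕ.+ k ∸ i))  ≡⟨ sumTo-truncate m k _ high-terms-vanish ⟩
  sumTo k (λ i → A i * shift m G (m ℕ.+ k ∸ i))          ≡⟨ sumTo-cong k low-terms ⟩
  (A ⊛ G) k                                              ≡⟨ sym (shift-+ m (A ⊛ G) k) ⟩
  shift m (A ⊛ G) (m ℕ.+ k)                              ∎
  where
  high-terms-vanish : ∀ i → k < i → i ≤ m ℕ.+ k → A i * shift m G (m ℕ.+ k ∸ i) ≡ 0ℚ
  high-terms-vanish i k<i i≤m+k = trans (cong (A i *_) (shift-< m G _
      (subst (m ℕ.+ k ∸ i <_) (ℕP.m+n∸n≡m m k) (ℕP.∸-monoʳ-< k<i i≤m+k))))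
    (ℚP.*-zeroʳ (A i))
  low-terms : ∀ i → i ≤ k → A i * shift m G (m ℕ.+ k ∸ i) ≡ A i * G (k ∸ i)
  low-terms i i≤k = cong (A i *_) (trans (cong (shift m G) (ℕP.+-∸-assoc m i≤k)) (shift-+ m G (k ∸ i)))

⊛-shiftStepʳ : ∀ m a A G j →
  (A ⊛ (λ i → G i + a * shift m G i)) j ≡ (A ⊛ G) j + a * shift m (A ⊛ G) j
⊛-shiftStepʳ m a A G j = trans (⊛-+ʳ A G (λ i → a * shift m G i) j)
  (cong (λ t → (A ⊛ G) j + t) (trans (⊛-*ʳ A a (shift m G) j) (cong (a *_) (⊛-shiftʳ m A G j))))

δ : ℕ → PowerSeries
δ p j with j ℕ.≟ p
... | yes _ = 1ℚ
... | no _  = 0ℚ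

δ-same : ∀ p → δ p p ≡ 1ℚ
δ-same p with p ℕ.≟ p
... | yes _   = refl
... | no  p≢p = ⊥-elim (p≢p refl)

δ-diff : ∀ p j → j ≢ p → δ p j ≡ 0ℚ
δ-diff p j j≢p with j ℕ.≟ p
... | yes j≡p = ⊥-elim (j≢p j≡p)
... | no  _   = refl

IsInt-δ : ∀ p j → IsInt (δ p j)
IsInt-δ p j with j ℕ.≟ p
... | yes _ = + 1 , refl
... | no _  = IsInt-0

δ≡shift : ∀ m j → δ m j ≡ shift m (δ 0) j
δ≡shift m j with split m j
... | below j<m        = trans (δ-diff m j (λ j≡m → ℕP.<-irrefl j≡m j<m)) (sym (shift-< m (δ 0) j j<m))
... | above zero refl = trans (cong (δ m) (ℕP.+-identityʳ m))
                          (trans (δ-same m) (sym (shift-+ m (δ 0) 0)))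
... | above (suc k) refl = trans (δ-diff m (m ℕ.+ suc k) (λ eq → ℕP.m+1+n≢m m eq))
                             (sym (shift-+ m (δ 0) (suc k)))

⊛-δ₀ : ∀ A j → (A ⊛ δ 0) j ≡ A j
⊛-δ₀ A zero    = ℚP.*-identityʳ (A 0)
⊛-δ₀ A (suc j) = begin
  (A ⊛ δ 0) (suc j)                                        ≡⟨ ⊛-comm A (δ 0) (suc j) ⟩
  (δ 0 ⊛ A) (suc j)                                        ≡⟨ sumTo-suc j (λ i → δ 0 i * A (suc j ∸ i)) ⟩
  1ℚ * A (suc j) + sumTo j (λ i → 0ℚ * A (j ∸ i))         ≡⟨ cong₂ _+_ (ℚP.*-identityˡ (A (suc j)))
                                                                (sumTo-zero j (λ i _ → ℚP.*-zeroˡ (A (j ∸ i)))) ⟩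
  A (suc j) + 0ℚ                                           ≡⟨ ℚP.+-identityʳ (A (suc j)) ⟩
  A (suc j)                                                ∎

⊛-δ : ∀ m A j → (A ⊛ δ m) j ≡ shift m A j
⊛-δ m A j = trans (⊛-congʳ A j (δ≡shift m))
  (trans (⊛-shiftʳ m A (δ 0) j) (shift-cong m (⊛-δ₀ A) j))

⊛-onePlusMonomial : ∀ a m G j → (G ⊛ onePlusMonomial a (suc m)) j ≡ G j + a * shift (suc m) G j
⊛-onePlusMonomial a m G j = begin
  (G ⊛ onePlusMonomial a (suc m)) j                          ≡⟨ ⊛-congʳ G j factor ⟩
  (G ⊛ (λ i → δ 0 i + a * shift (suc m) (δ 0) i)) j          ≡⟨ ⊛-shiftStepʳ (suc m) a G (δ 0) j ⟩
  (G ⊛ δ 0) j + a * shift (suc m) (G ⊛ δ 0) j                ≡⟨ cong₂ (λ x y → x + a * y) (⊛-δ₀ G j)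
                                                                   (shift-cong (suc m) (⊛-δ₀ G) j) ⟩
  G j + a * shift (suc m) G j                                ∎
  where
  factor : ∀ i → onePlusMonomial a (suc m) i ≡ δ 0 i + a * shift (suc m) (δ 0) i
  factor i rewrite sym (δ≡shift (suc m) i) with i ℕ.≟ 0 | i ℕ.≟ suc m
  ... | yes refl | yes ()
  ... | yes _    | no _   = solve 1 (λ a → con 1ℚ := con 1ℚ :+ a :* con 0ℚ) refl a
  ... | no _     | yes _  = solve 1 (λ a → a := con 0ℚ :+ a :* con 1ℚ) refl a
  ... | no _     | no _   = solve 1 (λ a → con 0ℚ := con 0ℚ :+ a :* con 0ℚ) refl a

θ : PowerSeries → PowerSeries
θ F j = ι j * F j

θ-shiftStep : ∀ m a F j →
  θ (λ i → F i + a * shift m F i) j ≡ (θ F j + a * shift m (θ F) j) + (ι m * a) * shift m F j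
θ-shiftStep m a F j with split m j
... | below j<m rewrite shift-< m (θ F) j j<m | shift-< m F j j<m =
  solve 4 (λ x f a y → x :* (f :+ a :* con 0ℚ) := (x :* f :+ a :* con 0ℚ) :+ (y :* a) :* con 0ℚ)
    refl (ι j) (F j) a (ι m)
... | above k refl rewrite shift-+ m (θ F) k | shift-+ m F k | ι-homo-+ m k =
  solve 5 (λ x y f g a → (x :+ y) :* (f :+ a :* g) := ((x :+ y) :* f :+ a :* (y :* g)) :+ (x :* a) :* g)
    refl (ι m) (ι k) (F (m ℕ.+ k)) (F k) a

-- The logarithmic derivative θ log(1 + a x^m) = - m Σ_{q ≥ 1} (-a)^q x^{qm}.
-- Its coefficient of x^{qm + r}, 0 ≤ r < m, is logCoeff m a q r.
logCoeff : ℕ → ℚ → ℕ → ℕ → ℚ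
logCoeff m a (suc q) zero = - (ι m * (- a) ^ suc q)
logCoeff m a _       _    = 0ℚ

logDeriv : ℚ → (m : ℕ) → .{{NonZero m}} → PowerSeries
logDeriv a m j = logCoeff m a (j DM./ m) (j DM.% m)

logCoeff-step : ∀ m .{{_ : NonZero m}} a q r →
  logCoeff m a (suc q) r + a * logCoeff m a q r ≡ (ι m * a) * δ 0 (r ℕ.+ q ℕ.* m)
logCoeff-step m a zero zero =
  solve 2 (λ x a → :- (x :* (:- a :* con 1ℚ)) :+ a :* con 0ℚ := (x :* a) :* con 1ℚ) refl (ι m) a
logCoeff-step m a zero (suc r) =
  solve 2 (λ x a → con 0ℚ :+ a :* con 0ℚ := (x :* a) :* con 0ℚ) refl (ι m) a
logCoeff-step m a (suc q) zero = begin
  - (ι m * (- a * (- a) ^ suc q)) + a * - (ι m * (- a) ^ suc q)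
    ≡⟨ solve 3 (λ x a p → :- (x :* (:- a :* p)) :+ a :* (:- (x :* p)) := (x :* a) :* con 0ℚ)
         refl (ι m) a ((- a) ^ suc q) ⟩
  (ι m * a) * 0ℚ
    ≡⟨ cong ((ι m * a) *_) (sym (δ-diff 0 (m ℕ.+ q ℕ.* m) (λ eq → ℕ.≢-nonZero⁻¹ m (ℕP.m+n≡0⇒m≡0 m eq)))) ⟩
  (ι m * a) * δ 0 (m ℕ.+ q ℕ.* m) ∎
logCoeff-step m a (suc q) (suc r) =
  solve 2 (λ x a → con 0ℚ :+ a :* con 0ℚ := (x :* a) :* con 0ℚ) refl (ι m) a

logDeriv-spec : ∀ a m .{{_ : NonZero m}} j →
  logDeriv a m j + a * shift m (logDeriv a m) j ≡ (ι m * a) * δ m j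
logDeriv-spec a m j with split m j
... | below j<m rewrite DM.m<n⇒m/n≡0 j<m | shift-< m (logDeriv a m) j j<m
                      | δ-diff m j (λ j≡m → ℕP.<-irrefl j≡m j<m) =
  solve 2 (λ x a → con 0ℚ :+ a :* con 0ℚ := (x :* a) :* con 0ℚ) refl (ι m) a
... | above k refl = begin
  logDeriv a m (m ℕ.+ k) + a * shift m (logDeriv a m) (m ℕ.+ k)
    ≡⟨ cong (λ t → logDeriv a m (m ℕ.+ k) + a * t) (shift-+ m (logDeriv a m) k) ⟩
  logDeriv a m (m ℕ.+ k) + a * logDeriv a m k
    ≡⟨ cong₂ (λ q r → logCoeff m a q r + a * logDeriv a m k) quotient remainder ⟩
  logCoeff m a (suc (k DM./ m)) (k DM.% m) + a * logCoeff m a (k DM./ m) (k DM.% m)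
    ≡⟨ logCoeff-step m a (k DM./ m) (k DM.% m) ⟩
  (ι m * a) * δ 0 (k DM.% m ℕ.+ k DM./ m ℕ.* m)
    ≡⟨ cong (λ i → (ι m * a) * δ 0 i) (sym (DM.m≡m%n+[m/n]*n k m)) ⟩
  (ι m * a) * δ 0 k
    ≡⟨ cong ((ι m * a) *_) (sym (trans (δ≡shift m (m ℕ.+ k)) (shift-+ m (δ 0) k))) ⟩
  (ι m * a) * δ m (m ℕ.+ k) ∎
  where
  quotient : (m ℕ.+ k) DM./ m ≡ suc (k DM./ m)
  quotient = trans (DM.m/n≡1+[m∸n]/n (ℕP.m≤m+n m k)) (cong (λ t → suc (t DM./ m)) (ℕP.m+n∸m≡n m k))
  remainder : (m ℕ.+ k) DM.% m ≡ k DM.% m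
  remainder = trans (cong (DM._% m) (ℕP.+-comm m k)) (DM.[m+n]%n≡m%n k m)

unitCancel : ∀ A D N → A 0 ≡ 1ℚ → (∀ j → j ≤ N → (A ⊛ D) j ≡ 0ℚ) → ∀ j → j ≤ N → D j ≡ 0ℚ
unitCancel A D N A₀≡1 AD≗0 = <-rec (λ j → j ≤ N → D j ≡ 0ℚ) λ j below j≤N →
  trans (sym (leadingTerm j (λ i i<j → below i<j (ℕP.≤-trans (ℕP.<⇒≤ i<j) j≤N)))) (AD≗0 j j≤N)
  where
  leadingTerm : ∀ j → (∀ i → i < j → D i ≡ 0ℚ) → (A ⊛ D) j ≡ D j
  leadingTerm zero    _     = trans (cong (_* D 0) A₀≡1) (ℚP.*-identityˡ (D 0))
  leadingTerm (suc j) lower = begin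
    (A ⊛ D) (suc j)                                     ≡⟨ sumTo-suc j (λ i → A i * D (suc j ∸ i)) ⟩
    A 0 * D (suc j) + sumTo j (λ i → A (suc i) * D (j ∸ i))
      ≡⟨ cong₂ _+_ (trans (cong (_* D (suc j)) A₀≡1) (ℚP.*-identityˡ (D (suc j))))
                   (sumTo-zero j (λ i i≤j → trans (cong (A (suc i) *_) (lower (j ∸ i) (s≤s (ℕP.m∸n≤m j i))))
                                                  (ℚP.*-zeroʳ (A (suc i))))) ⟩
    D (suc j) + 0ℚ                                      ≡⟨ ℚP.+-identityʳ (D (suc j)) ⟩
    D (suc j)                                           ∎

ι*reciprocal : ∀ d .{{_ : NonZero d}} → ι d * (+ 1 / d) ≡ 1ℚ
ι*reciprocal (suc d) rewrite /1-canonical (+ suc d)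
                          | ℚP.normalize-coprime {1} {d} (Coprime.1-coprimeTo (suc d)) =
  ℚP.*-inverseʳ (mkℚ (+ suc d) 0 (Coprime.sym (Coprime.1-coprimeTo (suc d))))

θ-exp : ∀ j → θ expSeries j ≡ shift 1 expSeries j
θ-exp zero    = trans (ℚP.*-zeroˡ (expSeries 0)) (sym (shift-< 1 expSeries 0 (s≤s z≤n)))
θ-exp (suc n) = begin
  ι (suc n) * a                         ≡⟨ sym (ℚP.*-identityʳ (ι (suc n) * a)) ⟩
  ι (suc n) * a * 1ℚ                    ≡⟨ cong (ι (suc n) * a *_) (sym (ι*reciprocal (n !) {{n ℕP.!≢0}})) ⟩
  ι (suc n) * a * (ι (n !) * b)
    ≡⟨ solve 4 (λ x a y b → x :* a :* (y :* b) := ((x :* y) :* a) :* b) refl (ι (suc n)) a (ι (n !)) b ⟩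
  (ι (suc n) * ι (n !)) * a * b         ≡⟨ cong (λ t → t * a * b) (sym (ι-homo-* (suc n) (n !))) ⟩
  ι (suc n !) * a * b                   ≡⟨ cong (_* b) (ι*reciprocal (suc n !) {{suc n ℕP.!≢0}}) ⟩
  1ℚ * b                                ≡⟨ ℚP.*-identityˡ b ⟩
  b                                     ≡⟨ sym (shift-+ 1 expSeries n) ⟩
  shift 1 expSeries (suc n)             ∎
  where
  a b : ℚ
  a = expSeries (suc n)
  b = expSeries n

module PartialProducts (e : ℕ → ℚ) where

  Q : ℕ → PowerSeries
  Q = partialProduct e

  S : ℕ → PowerSeries
  S zero    j = 0ℚ
  S (suc N) j = S N j + logDeriv (e (suc N)) (suc N) j

  Q-step : ∀ N j → Q (suc N) j ≡ Q N j + e (suc N) * shift (suc N) (Q N) j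
  Q-step N = ⊛-onePlusMonomial (e (suc N)) N (Q N)

  Q-step-⊛ : ∀ N G j → (Q (suc N) ⊛ G) j ≡ (Q N ⊛ G) j + e (suc N) * shift (suc N) (Q N ⊛ G) j
  Q-step-⊛ N G j = begin
    (Q (suc N) ⊛ G) j                                     ≡⟨ ⊛-comm (Q (suc N)) G j ⟩
    (G ⊛ Q (suc N)) j                                     ≡⟨ ⊛-congʳ G j (Q-step N) ⟩
    (G ⊛ (λ i → Q N i + a * shift m (Q N) i)) j           ≡⟨ ⊛-shiftStepʳ m a G (Q N) j ⟩
    (G ⊛ Q N) j + a * shift m (G ⊛ Q N) j
      ≡⟨ cong₂ (λ x y → x + a * y) (⊛-comm G (Q N) j) (shift-cong m (⊛-comm G (Q N)) j) ⟩
    (Q N ⊛ G) j + a * shift m (Q N ⊛ G) j                 ∎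
    where
    m : ℕ
    m = suc N
    a : ℚ
    a = e m

  Q-stable : ∀ d N j → j ≤ N → Q (d ℕ.+ N) j ≡ Q N j
  Q-stable zero    N j _   = refl
  Q-stable (suc d) N j j≤N = begin
    Q (suc (d ℕ.+ N)) j                                   ≡⟨ Q-step (d ℕ.+ N) j ⟩
    Q (d ℕ.+ N) j + e (suc (d ℕ.+ N)) * shift (suc (d ℕ.+ N)) (Q (d ℕ.+ N)) j
      ≡⟨ cong (λ t → Q (d ℕ.+ N) j + e (suc (d ℕ.+ N)) * t)
              (shift-< (suc (d ℕ.+ N)) (Q (d ℕ.+ N)) j (s≤s (ℕP.≤-trans j≤N (ℕP.m≤n+m N d)))) ⟩
    Q (d ℕ.+ N) j + e (suc (d ℕ.+ N)) * 0ℚ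
      ≡⟨ trans (cong (λ t → Q (d ℕ.+ N) j + t) (ℚP.*-zeroʳ (e (suc (d ℕ.+ N))))) (ℚP.+-identityʳ _) ⟩
    Q (d ℕ.+ N) j                                         ≡⟨ Q-stable d N j j≤N ⟩
    Q N j                                                 ∎

  θQ≡Q⊛S : ∀ N j → θ (Q N) j ≡ (Q N ⊛ S N) j
  θQ≡Q⊛S zero j = trans (θ-one j) (sym (sumTo-zero j (λ i _ → ℚP.*-zeroʳ (oneSeries i))))
    where
    θ-one : ∀ j → θ oneSeries j ≡ 0ℚ
    θ-one zero    = refl
    θ-one (suc j) = ℚP.*-zeroʳ (ι (suc j))
  θQ≡Q⊛S (suc N) j = sym (begin
    (Q (suc N) ⊛ S (suc N)) j
      ≡⟨ ⊛-+ʳ (Q (suc N)) (S N) T j ⟩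
    (Q (suc N) ⊛ S N) j + (Q (suc N) ⊛ T) j
      ≡⟨ cong₂ _+_ (Q-step-⊛ N (S N) j) (Q-step-⊛ N T j) ⟩
    ((Q N ⊛ S N) j + a * shift m (Q N ⊛ S N) j) + ((Q N ⊛ T) j + a * shift m (Q N ⊛ T) j)
      ≡⟨ cong₂ _+_ (cong₂ (λ x y → x + a * y) (sym (θQ≡Q⊛S N j)) (shift-cong m (λ i → sym (θQ≡Q⊛S N i)) j))
                   factor-term ⟩
    (θ (Q N) j + a * shift m (θ (Q N)) j) + (ι m * a) * shift m (Q N) j
      ≡⟨ sym (θ-shiftStep m a (Q N) j) ⟩
    ι j * (Q N j + a * shift m (Q N) j)
      ≡⟨ cong (ι j *_) (sym (Q-step N j)) ⟩
    θ (Q (suc N)) j ∎)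
    where
    m : ℕ
    m = suc N
    a : ℚ
    a = e m
    T : PowerSeries
    T = logDeriv a m
    factor-term : (Q N ⊛ T) j + a * shift m (Q N ⊛ T) j ≡ (ι m * a) * shift m (Q N) j
    factor-term = begin
      (Q N ⊛ T) j + a * shift m (Q N ⊛ T) j      ≡⟨ sym (⊛-shiftStepʳ m a (Q N) T j) ⟩
      (Q N ⊛ (λ i → T i + a * shift m T i)) j    ≡⟨ ⊛-congʳ (Q N) j (logDeriv-spec a m) ⟩
      (Q N ⊛ (λ i → (ι m * a) * δ m i)) j        ≡⟨ ⊛-*ʳ (Q N) (ι m * a) (δ m) j ⟩
      (ι m * a) * (Q N ⊛ δ m) j                  ≡⟨ cong ((ι m * a) *_) (⊛-δ m (Q N) j) ⟩
      (ι m * a) * shift m (Q N) j                ∎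

gcd[n,n]≡n : ∀ n → gcd n n ≡ n
gcd[n,n]≡n n = ∣-antisym (gcd[m,n]∣m n n) (gcd-greatest ∣-refl ∣-refl)

gcdProdFrom : ℕ → ℕ → ℕ → ℕ
gcdProdFrom s zero    N = 1
gcdProdFrom s (suc k) N = gcdProdFrom s k N ℕ.* gcd (s ℕ.+ suc k) N

gcdProdTo-split : ∀ s k N → gcdProdTo (s ℕ.+ k) N ≡ gcdProdTo s N ℕ.* gcdProdFrom s k N
gcdProdTo-split s zero    N = trans (cong (λ t → gcdProdTo t N) (ℕP.+-identityʳ s))
                                    (sym (ℕP.*-identityʳ (gcdProdTo s N)))
gcdProdTo-split s (suc k) N = begin
  gcdProdTo (s ℕ.+ suc k) N                                   ≡⟨ cong (λ t → gcdProdTo t N) (ℕP.+-suc s k) ⟩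
  gcdProdTo (s ℕ.+ k) N ℕ.* gcd (suc (s ℕ.+ k)) N
    ≡⟨ cong₂ ℕ._*_ (gcdProdTo-split s k N) (cong (λ t → gcd t N) (sym (ℕP.+-suc s k))) ⟩
  gcdProdTo s N ℕ.* gcdProdFrom s k N ℕ.* gcd (s ℕ.+ suc k) N ≡⟨ ℕP.*-assoc (gcdProdTo s N) _ _ ⟩
  gcdProdTo s N ℕ.* gcdProdFrom s (suc k) N                   ∎

-- If n ∣ N then gcd(i, n) ∣ gcd(jn + i, N), so a block of k factors of u_N
-- starting at a multiple of n is divisible by the first k factors of u_n.
gcdProdTo∣block : ∀ {n N} → n ∣ N → ∀ j k → gcdProdTo k n ∣ gcdProdFrom (j ℕ.* n) k N
gcdProdTo∣block n∣N j zero = ∣-refl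
gcdProdTo∣block {n} {N} n∣N j (suc k) = *-pres-∣ (gcdProdTo∣block n∣N j k) (gcd-greatest
  (∣m∣n⇒∣m+n (∣-trans (gcd[m,n]∣n (suc k) n) (n∣m*n j)) (gcd[m,n]∣m (suc k) n))
  (∣-trans (gcd[m,n]∣n (suc k) n) n∣N))

u^j∣gcdProdTo : ∀ {n N} → n ∣ N → ∀ j → u n ℕ.^ j ∣ gcdProdTo (j ℕ.* n) N
u^j∣gcdProdTo n∣N zero = ∣-refl
u^j∣gcdProdTo {n} {N} n∣N (suc j) = subst₂ _∣_ (ℕP.*-comm (u n ℕ.^ j) (u n))
  (trans (sym (gcdProdTo-split (j ℕ.* n) n N)) (cong (λ t → gcdProdTo t N) (ℕP.+-comm (j ℕ.* n) n)))
  (*-pres-∣ (u^j∣gcdProdTo n∣N j) (gcdProdTo∣block n∣N j n))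

-- The key divisibility: for N = K + 1 = (q+1) n we have
--   u_n^{q+1} ∣ (u_N / N) · n = ∏_{i ≤ K} gcd(i, N) · n.
-- The first q blocks of u_N give u_n^q, the last one u_n / n, and n itself.
u^q∣gcdProdTo*n : ∀ n' q K → suc K ≡ suc q ℕ.* suc n' →
  u (suc n') ℕ.^ suc q ∣ gcdProdTo K (suc K) ℕ.* suc n'
u^q∣gcdProdTo*n n' q K N≡qn =
  subst (λ N → u n ℕ.^ suc q ∣ gcdProdTo K N ℕ.* n) (sym N≡qn)
    (subst (λ k → u n ℕ.^ suc q ∣ gcdProdTo k (suc q ℕ.* n) ℕ.* n) (sym K≡qn+n')
      (subst₂ _∣_ (sym u^[q+1]) (sym rhs)
        (*-pres-∣ (u^j∣gcdProdTo n∣N q) (*-pres-∣ (gcdProdTo∣block n∣N q n') (∣-refl {n})))))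
  where
  n N : ℕ
  n = suc n'
  N = suc q ℕ.* n
  n∣N : n ∣ N
  n∣N = divides (suc q) refl
  K≡qn+n' : K ≡ q ℕ.* n ℕ.+ n'
  K≡qn+n' = trans (ℕP.suc-injective N≡qn) (ℕP.+-comm n' (q ℕ.* n))
  u^[q+1] : u n ℕ.^ suc q ≡ u n ℕ.^ q ℕ.* (gcdProdTo n' n ℕ.* n)
  u^[q+1] = trans (cong (λ g → gcdProdTo n' n ℕ.* g ℕ.* u n ℕ.^ q) (gcd[n,n]≡n n))
                  (ℕP.*-comm (gcdProdTo n' n ℕ.* n) (u n ℕ.^ q))
  rhs : gcdProdTo (q ℕ.* n ℕ.+ n') N ℕ.* n
        ≡ gcdProdTo (q ℕ.* n) N ℕ.* (gcdProdFrom (q ℕ.* n) n' N ℕ.* n)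
  rhs = trans (cong (ℕ._* n) (gcdProdTo-split (q ℕ.* n) n' N))
              (ℕP.*-assoc (gcdProdTo (q ℕ.* n) N) (gcdProdFrom (q ℕ.* n) n' N) n)

module Integrality (e : ℕ → ℚ) (hyp : IsExpProductExponents e) where
  open PartialProducts e

  Q-exp : ∀ N j → j ≤ N → Q N j ≡ expSeries j
  Q-exp N j j≤N = trans (cong (λ t → Q t j) (sym (ℕP.m∸n+n≡m j≤N)))
                        (trans (Q-stable (N ∸ j) j j ℕP.≤-refl) (hyp j))

  -- S_N ≡ x modulo x^{N+1}: since θ Q_N = Q_N S_N, Q_N ≡ exp and θ exp = x exp,
  -- the product Q_N (S_N - x) vanishes up to degree N, and Q_N has constant term 1.
  S-diagonal : ∀ N → S N N ≡ δ 1 N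
  S-diagonal N = begin
    S N N                 ≡⟨ solve 2 (λ s d → s := (s :+ con (- 1ℚ) :* d) :+ d) refl (S N N) (δ 1 N) ⟩
    E N + δ 1 N           ≡⟨ cong (_+ δ 1 N) (unitCancel (Q N) E N (Q-exp N 0 z≤n) QE-vanishes N ℕP.≤-refl) ⟩
    0ℚ + δ 1 N            ≡⟨ ℚP.+-identityˡ (δ 1 N) ⟩
    δ 1 N                 ∎
    where
    E : PowerSeries
    E i = S N i + (- 1ℚ) * δ 1 i
    QE-vanishes : ∀ j → j ≤ N → (Q N ⊛ E) j ≡ 0ℚ
    QE-vanishes j j≤N = begin
      (Q N ⊛ E) j
        ≡⟨ ⊛-+ʳ (Q N) (S N) (λ i → (- 1ℚ) * δ 1 i) j ⟩
      (Q N ⊛ S N) j + (Q N ⊛ (λ i → (- 1ℚ) * δ 1 i)) j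
        ≡⟨ cong₂ _+_ (sym (θQ≡Q⊛S N j))
                     (trans (⊛-*ʳ (Q N) (- 1ℚ) (δ 1) j) (cong ((- 1ℚ) *_) (⊛-δ 1 (Q N) j))) ⟩
      θ (Q N) j + (- 1ℚ) * shift 1 (Q N) j
        ≡⟨ cong₂ (λ x y → ι j * x + (- 1ℚ) * y) (Q-exp N j j≤N) (shift-agree 1 N (Q-exp N) j j≤N) ⟩
      θ expSeries j + (- 1ℚ) * shift 1 expSeries j
        ≡⟨ cong (λ t → t + (- 1ℚ) * shift 1 expSeries j) (θ-exp j) ⟩
      shift 1 expSeries j + (- 1ℚ) * shift 1 expSeries j
        ≡⟨ solve 1 (λ x → x :+ con (- 1ℚ) :* x := con 0ℚ) refl (shift 1 expSeries j) ⟩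
      0ℚ ∎

  coefficientFormula : ∀ K → ι (suc K) * e (suc K) ≡ δ 1 (suc K) - S K (suc K)
  coefficientFormula K = begin
    ι N * a                                 ≡⟨ solve 3 (λ x a s → x :* a := (s :+ :- (x :* (:- a :* con 1ℚ))) :- s)
                                                 refl (ι N) a (S K N) ⟩
    (S K N + - (ι N * (- a * 1ℚ))) - S K N  ≡⟨ cong (λ t → (S K N + t) - S K N) (sym ownTerm) ⟩
    S (suc K) N - S K N                     ≡⟨ cong (_- S K N) (S-diagonal N) ⟩
    δ 1 N - S K N                           ∎
    where
    N : ℕ
    N = suc K
    a : ℚ
    a = e N
    ownTerm : logDeriv a N N ≡ - (ι N * (- a * 1ℚ))
    ownTerm = cong₂ (logCoeff N a) (DM.n/n≡1 N) (DM.n%n≡0 N)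

  -- With c = u_N / N = ∏_{i ≤ K} gcd(i, N), each term c (θ log(1 + e_n x^n))_N
  -- is an integer once u_n e_n is: it vanishes unless N = qn, and then equals
  -- -w (u_n · (-e_n))^q for the integer w = c n / u_n^q.
  term-integral : ∀ K n' → IsInt (ι (u (suc n')) * e (suc n')) →
    IsInt (ι (gcdProdTo K (suc K)) * logDeriv (e (suc n')) (suc n') (suc K))
  term-integral K n' ue-int = byDivision (N DM./ n) (N DM.% n) (DM.m≡m%n+[m/n]*n N n)
    where
    N n c : ℕ
    N = suc K
    n = suc n'
    c = gcdProdTo K N
    b : ℚ
    b = e n
    byDivision : ∀ q r → N ≡ r ℕ.+ q ℕ.* n → IsInt (ι c * logCoeff n b q r)
    byDivision zero    r       _    = subst IsInt (sym (ℚP.*-zeroʳ (ι c))) IsInt-0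
    byDivision (suc q) (suc r) _    = subst IsInt (sym (ℚP.*-zeroʳ (ι c))) IsInt-0
    byDivision (suc q) zero    N≡qn =
      subst IsInt (sym value) (IsInt-neg (IsInt-* (IsInt-ι w) (IsInt-^ (suc q) ub-int)))
      where
      dv : u n ℕ.^ suc q ∣ c ℕ.* n
      dv = u^q∣gcdProdTo*n n' q K N≡qn
      w : ℕ
      w = _∣_.quotient dv
      ub-int : IsInt (ι (u n) * - b)
      ub-int = subst IsInt (ℚP.neg-distribʳ-* (ι (u n)) b) (IsInt-neg ue-int)
      value : ι c * logCoeff n b (suc q) zero ≡ - (ι w * (ι (u n) * - b) ^ suc q)
      value = begin
        ι c * - (ι n * (- b) ^ suc q)
          ≡⟨ solve 3 (λ c x p → c :* (:- (x :* p)) := :- ((c :* x) :* p)) refl (ι c) (ι n) ((- b) ^ suc q) ⟩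
        - (ι c * ι n * (- b) ^ suc q)
          ≡⟨ cong (λ t → - (t * (- b) ^ suc q)) (sym (ι-homo-* c n)) ⟩
        - (ι (c ℕ.* n) * (- b) ^ suc q)
          ≡⟨ cong (λ t → - (ι t * (- b) ^ suc q)) (_∣_.equality dv) ⟩
        - (ι (w ℕ.* u n ℕ.^ suc q) * (- b) ^ suc q)
          ≡⟨ cong (λ t → - (t * (- b) ^ suc q))
                  (trans (ι-homo-* w (u n ℕ.^ suc q)) (cong (ι w *_) (ι-homo-^ (u n) (suc q)))) ⟩
        - (ι w * ι (u n) ^ suc q * (- b) ^ suc q)
          ≡⟨ cong -_ (ℚP.*-assoc (ι w) (ι (u n) ^ suc q) ((- b) ^ suc q)) ⟩
        - (ι w * (ι (u n) ^ suc q * (- b) ^ suc q))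
          ≡⟨ cong (λ t → - (ι w * t)) (sym (^-distrib-* (ι (u n)) (- b) (suc q))) ⟩
        - (ι w * (ι (u n) * - b) ^ suc q) ∎

  u·e-integral : ∀ K → IsInt (ι (u (suc K)) * e (suc K))
  u·e-integral = <-rec (λ K → IsInt (ι (u (suc K)) * e (suc K))) step
    where
    step : ∀ K → (∀ {n'} → n' < K → IsInt (ι (u (suc n')) * e (suc n'))) →
           IsInt (ι (u (suc K)) * e (suc K))
    step K earlier = subst IsInt (sym ue≡) (IsInt-- (IsInt-* (IsInt-ι c) (IsInt-δ 1 N)) (partialSum K ℕP.≤-refl))
      where
      N c : ℕ
      N = suc K
      c = gcdProdTo K N
      partialSum : ∀ k → k ≤ K → IsInt (ι c * S k N)
      partialSum zero    _   = subst IsInt (sym (ℚP.*-zeroʳ (ι c))) IsInt-0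
      partialSum (suc k) k<K = subst IsInt (sym (ℚP.*-distribˡ-+ (ι c) (S k N) _))
        (IsInt-+ (partialSum k (ℕP.<⇒≤ k<K)) (term-integral K k (earlier k<K)))
      ue≡ : ι (u N) * e N ≡ ι c * δ 1 N - ι c * S K N
      ue≡ = begin
        ι (c ℕ.* gcd N N) * e N       ≡⟨ cong (λ g → ι (c ℕ.* g) * e N) (gcd[n,n]≡n N) ⟩
        ι (c ℕ.* N) * e N             ≡⟨ cong (_* e N) (ι-homo-* c N) ⟩
        ι c * ι N * e N               ≡⟨ ℚP.*-assoc (ι c) (ι N) (e N) ⟩
        ι c * (ι N * e N)             ≡⟨ cong (ι c *_) (coefficientFormula K) ⟩
        ι c * (δ 1 N - S K N)         ≡⟨ solve 3 (λ c d s → c :* (d :- s) := c :* d :- c :* s)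
                                           refl (ι c) (δ 1 N) (S K N) ⟩
        ι c * δ 1 N - ι c * S K N     ∎

mainTheorem5 : (e : ℕ → ℚ) → IsExpProductExponents e →
    ∀ (n : ℕ) → n ≥ 1 → ∃ λ (z : ℤ) → (+ u n / 1) * e n ≡ z / 1
mainTheorem5 e hyp (suc n) _ = Integrality.u·e-integral e hyp n
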